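{- Let $a_1,a_2>0$ and let $[\mathcal{E}_{n,k}]_{n,k\ge0}$ be defined by $\mathcal{E}_{0,0}=1$, $\mathcal{E}_{n,k}=0$ unless $0\le k\le n$, and for $n\ge1$ $$\mathcal{E}_{n,k}=(a_1k+a_2)\mathcal{E}_{n-1,k}+(a_1n-a_1k+a_2)\mathcal{E}_{n-1,k-1},$$ with $\mathcal{E}_n(x)=\sum_k\mathcal{E}_{n,k}x^k$. Let $c>0$. Then there exists a triangle $[\mathcal{S}_{n,k}]_{n,k\ge0}$ of nonnegative numbers with $\mathcal{S}_{0,0}=1$, $\mathcal{S}_{n,k}=0$ unless $0\le k\le (n+1)/2$, satisfying for $n\ge1$ $$\mathcal{S}_{n,k}=(a_1k+a_2)\mathcal{S}_{n-1,k}+c(n-2k+1)\mathcal{S}_{n-1,k-1},$$ such that, with $\mathcal{S}_n(x)=\sum_k\mathcal{S}_{n,k}x^k$, $$\mathcal{E}_n(x)=(1+x)^n\,\mathcal{S}_n\!\left(\frac{\frac{2a_1}{c}x}{(1+x)^2}\right)\quad\text{for all } n\ge1.$$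
   Formalization: The parameters $a_1,a_2$ and $c$ are positive rationals instead of positive reals, the identity is asserted for rational x, and the entries of the triangle $[\mathcal{S}_{n,k}]$ are taken in ℚ. -}

module Defs where

open import Data.Nat as ℕ using (ℕ; zero; suc)
open import Data.Integer using (+_)
open import Data.Rational using (ℚ; 0ℚ; 1ℚ; _+_; _*_; _-_; _÷_; _<_; _≤_; NonZero; >-nonZero; ≢-nonZero)
open import Relation.Binary.PropositionalEquality using (_≡_; _≢_)

ι : ℕ → ℚ
ι n = + n / 1
  where open Data.Rational using (_/_)

infixr 8 _^_
_^_ : ℚ → ℕ → ℚ
x ^ zero  = 1ℚ
x ^ suc n = x * x ^ n

sumTo : ℕ → (ℕ → ℚ) → ℚ
sumTo zero    f = f 0
sumTo (suc n) f = sumTo n f + f (suc n)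

E : ℚ → ℚ → ℕ → ℕ → ℚ
E a₁ a₂ zero    zero    = 1ℚ
E a₁ a₂ zero    (suc k) = 0ℚ
E a₁ a₂ (suc n) zero    = a₂ * E a₁ a₂ n zero
E a₁ a₂ (suc n) (suc k) =
  (a₁ * ι (suc k) + a₂) * E a₁ a₂ n (suc k)
  + (a₁ * ι (suc n) - a₁ * ι (suc k) + a₂) * E a₁ a₂ n k

-- ℰ_n(x) = Σ_k ℰ_{n,k} x^k  (ℰ_{n,k} = 0 for k > n)
Epoly : ℚ → ℚ → ℕ → ℚ → ℚ
Epoly a₁ a₂ n x = sumTo n (λ k → E a₁ a₂ n k * x ^ k)

-- S_n(y) = Σ_k S_{n,k} y^k for a triangle supported on 0 ≤ k ≤ (n+1)/2 ≤ n (n ≥ 1)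
poly : (ℕ → ℕ → ℚ) → ℕ → ℚ → ℚ
poly S n y = sumTo n (λ k → S n k * y ^ k)

arg : (a₁ c x : ℚ) → 0ℚ < c → (1ℚ + x) ≢ 0ℚ → ℚ
arg a₁ c x c>0 1+x≢0 =
  _÷_ (_÷_ ((_÷_ (ι 2 * a₁) c {{>-nonZero c>0}}) * x)
           (1ℚ + x) {{≢-nonZero 1+x≢0}})
      (1ℚ + x) {{≢-nonZero 1+x≢0}}

{-# OPTIONS --safe #-}

-- Put q = 2a₁/c and T n k = S n k · qᵏ.  Read as an operator on coefficient sequences,
-- the recurrence of ℰ sends xᵏ(1 + x)ᵐ, where n = 2k + m, to
--   (a₁k + a₂) xᵏ(1 + x)ᵐ⁺¹ + 2a₁m xᵏ⁺¹(1 + x)ᵐ⁻¹,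
-- which comes down to the absorption identities (k + 1) C(m, k + 1) = m C(m - 1, k) = (m - k) C(m, k).
-- Hence the coefficients of ℰₙ in the basis xᵏ(1 + x)ⁿ⁻²ᵏ obey the recurrence of S rescaled by qᵏ, so
--   ℰₙ(x) = Σₖ T n k xᵏ(1 + x)ⁿ⁻²ᵏ = (1 + x)ⁿ Sₙ(q x / (1 + x)²).

module Submission where

open import Defs
open import Data.Nat using (ℕ; zero; suc; _<_) renaming (_*_ to _*ℕ_; _≤_ to _≤ℕ_)
open import Data.Product using (Σ; _×_; _,_)
open import Data.Rational using (ℚ; 0ℚ; 1ℚ; _+_; _*_; _-_) renaming (_<_ to _<ℚ_; _≤_ to _≤ℚ_)
open import Relation.Binary.PropositionalEquality using (_≡_; _≢_)

import Data.Integer as ℤ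
open import Data.Integer.Tactic.RingSolver renaming (solve-∀ to ℤ-solve-∀)
open import Data.Nat as ℕ using (_∸_; pred; s≤s; _≤?_)
import Data.Nat.Properties as ℕ
open import Data.Nat.Combinatorics using (_C_; nCk+nC[k+1]≡[n+1]C[k+1]; k>n⇒nCk≡0)
open import Data.Rational using (toℚᵘ; NonZero; nonNegative; _÷_; 1/_; >-nonZero; ≢-nonZero)
open import Data.Rational.Properties
  using (_≟_; +-*-commutativeRing; toℚᵘ-injective; toℚᵘ-fromℚᵘ; toℚᵘ-homo-+;
         +-assoc; *-comm; +-identityˡ; +-identityʳ; *-assoc; *-identityˡ; *-zeroˡ; *-zeroʳ; *-distribˡ-+; *-distribʳ-+;
         *-identityʳ; *-inverseˡ; +-mono-≤; ≤-refl; nonNegative⁻¹; nonNeg*nonNeg⇒nonNeg; normalize-nonNeg; <⇒≤)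
import Data.Rational.Unnormalised as ℚᵘ
import Data.Rational.Unnormalised.Properties as ℚᵘ
open import Level using (0ℓ)
open import Relation.Binary.PropositionalEquality using (refl; sym; trans; cong; cong₂; subst; module ≡-Reasoning)
open import Relation.Nullary using (yes; no)
open import Relation.Nullary.Decidable using (dec⇒maybe)
open import Tactic.RingSolver using (solve-∀)
import Data.Nat.Tactic.RingSolver as NS
open import Tactic.RingSolver.Core.AlmostCommutativeRing using (AlmostCommutativeRing; fromCommutativeRing)

open ≡-Reasoning

ℚ-ring : AlmostCommutativeRing 0ℓ 0ℓ
ℚ-ring = fromCommutativeRing +-*-commutativeRing (λ p → dec⇒maybe (0ℚ ≟ p))

ι-+ : ∀ m n → ι (m ℕ.+ n) ≡ ι m + ι n
ι-+ m n = toℚᵘ-injective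
  (ℚᵘ.≃-trans (ιᵘ (m ℕ.+ n))
  (ℚᵘ.≃-trans (ℚᵘ.*≡* (cross-multiplied (ℤ.+ m) (ℤ.+ n)))
  (ℚᵘ.≃-sym (ℚᵘ.≃-trans (toℚᵘ-homo-+ (ι m) (ι n)) (ℚᵘ.+-cong (ιᵘ m) (ιᵘ n))))))
  where
  -- ι n is definitionally fromℚᵘ (n / 1).
  ιᵘ : ∀ n → toℚᵘ (ι n) ℚᵘ.≃ ℚᵘ.mkℚᵘ (ℤ.+ n) 0
  ιᵘ n = toℚᵘ-fromℚᵘ (ℚᵘ.mkℚᵘ (ℤ.+ n) 0)
  cross-multiplied : ∀ i j → (i ℤ.+ j) ℤ.* (ℤ.1ℤ ℤ.* ℤ.1ℤ) ≡ (i ℤ.* ℤ.1ℤ ℤ.+ j ℤ.* ℤ.1ℤ) ℤ.* ℤ.1ℤ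
  cross-multiplied = ℤ-solve-∀

ι-suc : ∀ n → ι (suc n) ≡ 1ℚ + ι n
ι-suc = ι-+ 1

ι-* : ∀ m n → ι (m ℕ.* n) ≡ ι m * ι n
ι-* zero    n = sym (*-zeroˡ (ι n))
ι-* (suc m) n = begin
  ι (n ℕ.+ m ℕ.* n)   ≡⟨ ι-+ n (m ℕ.* n) ⟩
  ι n + ι (m ℕ.* n)   ≡⟨ cong (ι n +_) (ι-* m n) ⟩
  ι n + ι m * ι n     ≡⟨ distrib (ι m) (ι n) ⟩
  (1ℚ + ι m) * ι n    ≡⟨ cong (_* ι n) (ι-suc m) ⟨
  ι (suc m) * ι n     ∎
  where
  distrib : ∀ a b → b + a * b ≡ (1ℚ + a) * b
  distrib = solve-∀ ℚ-ring

ι-nonNeg : ∀ n → 0ℚ ≤ℚ ι n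
ι-nonNeg n = nonNegative⁻¹ (ι n) {{normalize-nonNeg n 1}}

ι-suc-+ : ∀ m n → ι (suc (m ℕ.+ n)) ≡ 1ℚ + (ι m + ι n)
ι-suc-+ m n = trans (ι-suc (m ℕ.+ n)) (cong (1ℚ +_) (ι-+ m n))

*-nonNeg : ∀ {p q} → 0ℚ ≤ℚ p → 0ℚ ≤ℚ q → 0ℚ ≤ℚ p * q
*-nonNeg {p} {q} 0≤p 0≤q = nonNegative⁻¹ (p * q) {{nonNeg*nonNeg⇒nonNeg p {{nonNegative 0≤p}} q {{nonNegative 0≤q}}}}

^-distribˡ-+-* : ∀ x m n → x ^ (m ℕ.+ n) ≡ x ^ m * x ^ n
^-distribˡ-+-* x zero    n = sym (*-identityˡ (x ^ n))
^-distribˡ-+-* x (suc m) n = trans (cong (x *_) (^-distribˡ-+-* x m n)) (sym (*-assoc x (x ^ m) (x ^ n)))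

^-distribʳ-* : ∀ x y n → (x * y) ^ n ≡ x ^ n * y ^ n
^-distribʳ-* x y zero    = refl
^-distribʳ-* x y (suc n) = trans (cong (x * y *_) (^-distribʳ-* x y n)) (interchange x y (x ^ n) (y ^ n))
  where
  interchange : ∀ a b c d → a * b * (c * d) ≡ a * c * (b * d)
  interchange = solve-∀ ℚ-ring

x*[y*z]≡y*[x*z] : ∀ x y z → x * (y * z) ≡ y * (x * z)
x*[y*z]≡y*[x*z] = solve-∀ ℚ-ring

p÷q*q≡p : ∀ p q .{{_ : NonZero q}} → (p ÷ q) * q ≡ p
p÷q*q≡p p q = begin
  p * 1/ q * q     ≡⟨ *-assoc p (1/ q) q ⟩
  p * (1/ q * q)   ≡⟨ cong (p *_) (*-inverseˡ q) ⟩
  p * 1ℚ           ≡⟨ *-identityʳ p ⟩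
  p                ∎

sumTo-cong : ∀ n {f g : ℕ → ℚ} → (∀ k → f k ≡ g k) → sumTo n f ≡ sumTo n g
sumTo-cong zero    f≗g = f≗g 0
sumTo-cong (suc n) f≗g = cong₂ _+_ (sumTo-cong n f≗g) (f≗g (suc n))

sumTo-distrib-+ : ∀ n (f g : ℕ → ℚ) → sumTo n (λ k → f k + g k) ≡ sumTo n f + sumTo n g
sumTo-distrib-+ zero    f g = refl
sumTo-distrib-+ (suc n) f g = trans (cong (_+ (f (suc n) + g (suc n))) (sumTo-distrib-+ n f g))
                                    (interchange (sumTo n f) (sumTo n g) (f (suc n)) (g (suc n)))
  where
  interchange : ∀ a b c d → (a + b) + (c + d) ≡ (a + c) + (b + d)
  interchange = solve-∀ ℚ-ring

*-distribˡ-sumTo : ∀ n a (f : ℕ → ℚ) → a * sumTo n f ≡ sumTo n (λ k → a * f k)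
*-distribˡ-sumTo zero    a f = refl
*-distribˡ-sumTo (suc n) a f = trans (*-distribˡ-+ a (sumTo n f) (f (suc n)))
                                     (cong (_+ a * f (suc n)) (*-distribˡ-sumTo n a f))

*-distribʳ-sumTo : ∀ n a (f : ℕ → ℚ) → sumTo n f * a ≡ sumTo n (λ k → f k * a)
*-distribʳ-sumTo zero    a f = refl
*-distribʳ-sumTo (suc n) a f = trans (*-distribʳ-+ a (sumTo n f) (f (suc n)))
                                     (cong (_+ f (suc n) * a) (*-distribʳ-sumTo n a f))

sumTo-suc : ∀ n (f : ℕ → ℚ) → sumTo (suc n) f ≡ f 0 + sumTo n (λ k → f (suc k))
sumTo-suc zero    f = refl
sumTo-suc (suc n) f = trans (cong (_+ f (suc (suc n))) (sumTo-suc n f))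
                            (+-assoc (f 0) (sumTo n (λ k → f (suc k))) (f (suc (suc n))))

sumTo-comm : ∀ n m (f : ℕ → ℕ → ℚ) →
  sumTo n (λ j → sumTo m (f j)) ≡ sumTo m (λ k → sumTo n (λ j → f j k))
sumTo-comm zero    m f = refl
sumTo-comm (suc n) m f = trans (cong (_+ sumTo m (f (suc n))) (sumTo-comm n m f))
                               (sym (sumTo-distrib-+ m (λ k → sumTo n (λ j → f j k)) (f (suc n))))

sumTo-extend : ∀ t d (f : ℕ → ℚ) → (∀ j → d < j → f j ≡ 0ℚ) → sumTo (t ℕ.+ d) f ≡ sumTo d f
sumTo-extend zero    d f f>d≡0 = refl
sumTo-extend (suc t) d f f>d≡0 = begin
  sumTo (t ℕ.+ d) f + f (suc (t ℕ.+ d)) ≡⟨ cong₂ _+_ (sumTo-extend t d f f>d≡0) (f>d≡0 _ (s≤s (ℕ.m≤n+m d t))) ⟩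
  sumTo d f + 0ℚ                       ≡⟨ +-identityʳ (sumTo d f) ⟩
  sumTo d f                            ∎

mutual
  [k+1]*[n+1]C[k+1]≡[n+1]*nCk : ∀ n k → suc k ℕ.* (suc n C suc k) ≡ suc n ℕ.* (n C k)
  [k+1]*[n+1]C[k+1]≡[n+1]*nCk zero    zero    = refl
  [k+1]*[n+1]C[k+1]≡[n+1]*nCk zero    (suc k) = ℕ.*-zeroʳ (suc (suc k))
  [k+1]*[n+1]C[k+1]≡[n+1]*nCk (suc n) k       = begin
    suc k ℕ.* (suc (suc n) C suc k)
      ≡⟨ cong (suc k ℕ.*_) (nCk+nC[k+1]≡[n+1]C[k+1] (suc n) k) ⟨
    suc k ℕ.* (suc n C k ℕ.+ suc n C suc k)
      ≡⟨ regroup (suc n C k) (suc n C suc k) k ⟩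
    suc n C k ℕ.+ (k ℕ.* (suc n C k) ℕ.+ suc k ℕ.* (suc n C suc k))
      ≡⟨ cong (λ u → suc n C k ℕ.+ (k ℕ.* (suc n C k) ℕ.+ u)) ([k+1]*[n+1]C[k+1]≡[n+1]*nCk n k) ⟩
    suc n C k ℕ.+ (k ℕ.* (suc n C k) ℕ.+ suc n ℕ.* (n C k))
      ≡⟨ cong (suc n C k ℕ.+_) (k*[n+1]Ck+[n+1]*nCk≡[n+1]*[n+1]Ck n k) ⟩
    suc n C k ℕ.+ suc n ℕ.* (suc n C k)
      ≡⟨⟩
    suc (suc n) ℕ.* (suc n C k)
      ∎
    where
    regroup : ∀ a b k → suc k ℕ.* (a ℕ.+ b) ≡ a ℕ.+ (k ℕ.* a ℕ.+ suc k ℕ.* b)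
    regroup = NS.solve-∀

  k*[n+1]Ck+[n+1]*nCk≡[n+1]*[n+1]Ck : ∀ n k → k ℕ.* (suc n C k) ℕ.+ suc n ℕ.* (n C k) ≡ suc n ℕ.* (suc n C k)
  k*[n+1]Ck+[n+1]*nCk≡[n+1]*[n+1]Ck n zero    = refl
  k*[n+1]Ck+[n+1]*nCk≡[n+1]*[n+1]Ck n (suc k) = begin
    suc k ℕ.* (suc n C suc k) ℕ.+ suc n ℕ.* (n C suc k)
      ≡⟨ cong (ℕ._+ suc n ℕ.* (n C suc k)) ([k+1]*[n+1]C[k+1]≡[n+1]*nCk n k) ⟩
    suc n ℕ.* (n C k) ℕ.+ suc n ℕ.* (n C suc k)
      ≡⟨ ℕ.*-distribˡ-+ (suc n) (n C k) (n C suc k) ⟨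
    suc n ℕ.* (n C k ℕ.+ n C suc k)
      ≡⟨ cong (suc n ℕ.*_) (nCk+nC[k+1]≡[n+1]C[k+1] n k) ⟩
    suc n ℕ.* (suc n C suc k)
      ∎

[k+1]nC[k+1]+[n-k]nCk≡2n[n-1]Ck : ∀ n k →
  ι (suc k) * ι (n C suc k) + (ι n - ι k) * ι (n C k) ≡ ι 2 * ι n * ι (pred n C k)
[k+1]nC[k+1]+[n-k]nCk≡2n[n-1]Ck zero    zero    = refl
[k+1]nC[k+1]+[n-k]nCk≡2n[n-1]Ck zero    (suc k) = vanish (ι (suc (suc k))) (ι 0 - ι (suc k))
  where
  vanish : ∀ a b → a * 0ℚ + b * 0ℚ ≡ 0ℚ
  vanish = solve-∀ ℚ-ring
[k+1]nC[k+1]+[n-k]nCk≡2n[n-1]Ck (suc n) k = begin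
  ι (suc k) * ι (suc n C suc k) + (ι (suc n) - ι k) * ι (suc n C k)
    ≡⟨ cong (_+ (ι (suc n) - ι k) * ι (suc n C k)) absorption ⟩
  ι (suc n) * ι (n C k) + (ι (suc n) - ι k) * ι (suc n C k)
    ≡⟨ expand (ι (suc n)) (ι k) (ι (n C k)) (ι (suc n C k)) ⟩
  ι (suc n) * ι (n C k) - ι k * ι (suc n C k) + ι (suc n) * ι (suc n C k)
    ≡⟨ cong (ι (suc n) * ι (n C k) - ι k * ι (suc n C k) +_) pascal ⟨
  ι (suc n) * ι (n C k) - ι k * ι (suc n C k) + (ι k * ι (suc n C k) + ι (suc n) * ι (n C k))
    ≡⟨ collect (ι (suc n)) (ι k) (ι (n C k)) (ι (suc n C k)) ⟩
  (1ℚ + 1ℚ) * ι (suc n) * ι (n C k)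
    ∎
  where
  absorption : ι (suc k) * ι (suc n C suc k) ≡ ι (suc n) * ι (n C k)
  absorption = begin
    ι (suc k) * ι (suc n C suc k) ≡⟨ ι-* (suc k) (suc n C suc k) ⟨
    ι (suc k ℕ.* (suc n C suc k)) ≡⟨ cong ι ([k+1]*[n+1]C[k+1]≡[n+1]*nCk n k) ⟩
    ι (suc n ℕ.* (n C k))         ≡⟨ ι-* (suc n) (n C k) ⟩
    ι (suc n) * ι (n C k)         ∎
  pascal : ι k * ι (suc n C k) + ι (suc n) * ι (n C k) ≡ ι (suc n) * ι (suc n C k)
  pascal = begin
    ι k * ι (suc n C k) + ι (suc n) * ι (n C k)
      ≡⟨ cong₂ _+_ (ι-* k (suc n C k)) (ι-* (suc n) (n C k)) ⟨
    ι (k ℕ.* (suc n C k)) + ι (suc n ℕ.* (n C k))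
      ≡⟨ ι-+ (k ℕ.* (suc n C k)) (suc n ℕ.* (n C k)) ⟨
    ι (k ℕ.* (suc n C k) ℕ.+ suc n ℕ.* (n C k))
      ≡⟨ cong ι (k*[n+1]Ck+[n+1]*nCk≡[n+1]*[n+1]Ck n k) ⟩
    ι (suc n ℕ.* (suc n C k))
      ≡⟨ ι-* (suc n) (suc n C k) ⟩
    ι (suc n) * ι (suc n C k)
      ∎
  expand : ∀ s k cₙ c₀ → s * cₙ + (s - k) * c₀ ≡ s * cₙ - k * c₀ + s * c₀
  expand = solve-∀ ℚ-ring
  collect : ∀ s k cₙ c₀ → s * cₙ - k * c₀ + (k * c₀ + s * cₙ) ≡ (1ℚ + 1ℚ) * s * cₙ
  collect = solve-∀ ℚ-ring

shift : (ℕ → ℚ) → ℕ → ℚ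
shift p zero    = 0ℚ
shift p (suc j) = p j

-- B k m is the coefficient sequence of xᵏ (1 + x)ᵐ.
B : ℕ → ℕ → ℕ → ℚ
B zero    m j = ι (m C j)
B (suc k) m   = shift (B k m)

B-at : ∀ k m i → B k m (i ℕ.+ k) ≡ ι (m C i)
B-at zero    m i = cong (λ j → ι (m C j)) (ℕ.+-identityʳ i)
B-at (suc k) m i = trans (cong (B (suc k) m) (ℕ.+-suc i k)) (B-at k m i)

B-below : ∀ k m j → j < k → B k m j ≡ 0ℚ
B-below (suc k) m zero    _         = refl
B-below (suc k) m (suc j) (s≤s j<k) = B-below k m j j<k

B-above : ∀ k m j → k ℕ.+ m < j → B k m j ≡ 0ℚ
B-above zero    m j       m<j         = cong ι (k>n⇒nCk≡0 m<j)
B-above (suc k) m (suc j) (s≤s k+m<j) = B-above k m j k+m<j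

B-pascal : ∀ m j → B 0 (suc m) j ≡ B 1 m j + B 0 m j
B-pascal m zero    = refl
B-pascal m (suc j) = trans (sym (cong ι (nCk+nC[k+1]≡[n+1]C[k+1] m j))) (ι-+ (m C j) (m C suc j))

eval : ℕ → (ℕ → ℚ) → ℚ → ℚ
eval N p x = sumTo N (λ j → p j * x ^ j)

eval-+ : ∀ N (p q : ℕ → ℚ) x → eval N (λ j → p j + q j) x ≡ eval N p x + eval N q x
eval-+ N p q x = trans (sumTo-cong N (λ j → *-distribʳ-+ (x ^ j) (p j) (q j)))
                       (sumTo-distrib-+ N (λ j → p j * x ^ j) (λ j → q j * x ^ j))

eval-shift : ∀ N p x → eval (suc N) (shift p) x ≡ x * eval N p x
eval-shift N p x = begin
  eval (suc N) (shift p) x                 ≡⟨ sumTo-suc N (λ j → shift p j * x ^ j) ⟩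
  0ℚ + sumTo N (λ j → p j * (x * x ^ j))   ≡⟨ +-identityˡ _ ⟩
  sumTo N (λ j → p j * (x * x ^ j))        ≡⟨ sumTo-cong N (λ j → x*[y*z]≡y*[x*z] (p j) x (x ^ j)) ⟩
  sumTo N (λ j → x * (p j * x ^ j))        ≡⟨ *-distribˡ-sumTo N x (λ j → p j * x ^ j) ⟨
  x * eval N p x                           ∎

eval-extend : ∀ t d p x → (∀ j → d < j → p j ≡ 0ℚ) → eval (t ℕ.+ d) p x ≡ eval d p x
eval-extend t d p x p>d≡0 =
  sumTo-extend t d _ (λ j d<j → trans (cong (_* x ^ j) (p>d≡0 j d<j)) (*-zeroˡ (x ^ j)))

eval-sum : ∀ N M (t : ℕ → ℚ) (f : ℕ → ℕ → ℚ) x →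
  eval N (λ j → sumTo M (λ k → t k * f k j)) x ≡ sumTo M (λ k → t k * eval N (f k) x)
eval-sum N M t f x = begin
  sumTo N (λ j → sumTo M (λ k → t k * f k j) * x ^ j)
    ≡⟨ sumTo-cong N (λ j → *-distribʳ-sumTo M (x ^ j) (λ k → t k * f k j)) ⟩
  sumTo N (λ j → sumTo M (λ k → t k * f k j * x ^ j))
    ≡⟨ sumTo-comm N M (λ j k → t k * f k j * x ^ j) ⟩
  sumTo M (λ k → sumTo N (λ j → t k * f k j * x ^ j))
    ≡⟨ sumTo-cong M (λ k → sumTo-cong N (λ j → *-assoc (t k) (f k j) (x ^ j))) ⟩
  sumTo M (λ k → sumTo N (λ j → t k * (f k j * x ^ j)))
    ≡⟨ sumTo-cong M (λ k → *-distribˡ-sumTo N (t k) (λ j → f k j * x ^ j)) ⟨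
  sumTo M (λ k → t k * eval N (f k) x)
    ∎

eval-binomial : ∀ m x → eval m (B 0 m) x ≡ (1ℚ + x) ^ m
eval-binomial zero    x = refl
eval-binomial (suc m) x = begin
  eval (suc m) (B 0 (suc m)) x
    ≡⟨ sumTo-cong (suc m) (λ j → cong (_* x ^ j) (B-pascal m j)) ⟩
  eval (suc m) (λ j → B 1 m j + B 0 m j) x
    ≡⟨ eval-+ (suc m) (B 1 m) (B 0 m) x ⟩
  eval (suc m) (B 1 m) x + eval (suc m) (B 0 m) x
    ≡⟨ cong₂ _+_ (eval-shift m (B 0 m) x) (eval-extend 1 m (B 0 m) x (B-above 0 m)) ⟩
  x * eval m (B 0 m) x + eval m (B 0 m) x
    ≡⟨ cong (λ u → x * u + u) (eval-binomial m x) ⟩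
  x * (1ℚ + x) ^ m + (1ℚ + x) ^ m
    ≡⟨ factor x ((1ℚ + x) ^ m) ⟩
  (1ℚ + x) ^ suc m
    ∎
  where
  factor : ∀ x u → x * u + u ≡ (1ℚ + x) * u
  factor = solve-∀ ℚ-ring

eval-basis : ∀ k m x → eval (k ℕ.+ m) (B k m) x ≡ x ^ k * (1ℚ + x) ^ m
eval-basis zero    m x = trans (eval-binomial m x) (sym (*-identityˡ _))
eval-basis (suc k) m x = begin
  eval (suc (k ℕ.+ m)) (B (suc k) m) x   ≡⟨ eval-shift (k ℕ.+ m) (B k m) x ⟩
  x * eval (k ℕ.+ m) (B k m) x           ≡⟨ cong (x *_) (eval-basis k m x) ⟩
  x * (x ^ k * (1ℚ + x) ^ m)             ≡⟨ *-assoc x (x ^ k) _ ⟨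
  x ^ suc k * (1ℚ + x) ^ m               ∎

data Position : ℕ → ℕ → Set where
  outside : ∀ {n k} → n < k ℕ.+ k → Position n k
  inside  : ∀ k m → Position (k ℕ.+ k ℕ.+ m) k

position : ∀ n k → Position n k
position n k with k ℕ.+ k ≤? n
... | yes 2k≤n = subst (λ n → Position n k) (ℕ.m+[n∸m]≡n 2k≤n) (inside k (n ∸ (k ℕ.+ k)))
... | no  2k≰n = outside (ℕ.≰⇒> 2k≰n)

module Recurrence (a₁ a₂ : ℚ) where

  step : ℕ → (ℕ → ℚ) → ℕ → ℚ
  step n p zero    = a₂ * p 0
  step n p (suc j) = (a₁ * ι (suc j) + a₂) * p (suc j) + (a₁ * ι (suc n) - a₁ * ι (suc j) + a₂) * p j

  E-suc : ∀ n j → E a₁ a₂ (suc n) j ≡ step n (E a₁ a₂ n) j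
  E-suc n zero    = refl
  E-suc n (suc j) = refl

  step-cong : ∀ n {p q : ℕ → ℚ} → (∀ j → p j ≡ q j) → ∀ j → step n p j ≡ step n q j
  step-cong n p≗q zero    = cong (a₂ *_) (p≗q 0)
  step-cong n p≗q (suc j) = cong₂ (λ u v → (a₁ * ι (suc j) + a₂) * u + (a₁ * ι (suc n) - a₁ * ι (suc j) + a₂) * v)
                                  (p≗q (suc j)) (p≗q j)

  step-sum : ∀ n M (t : ℕ → ℚ) (f : ℕ → ℕ → ℚ) j →
    step n (λ i → sumTo M (λ k → t k * f k i)) j ≡ sumTo M (λ k → t k * step n (f k) j)
  step-sum n M t f zero    = trans (*-distribˡ-sumTo M a₂ (λ k → t k * f k 0))
                                   (sumTo-cong M (λ k → x*[y*z]≡y*[x*z] a₂ (t k) (f k 0)))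
  step-sum n M t f (suc j) = begin
    α * sumTo M (λ k → t k * f k (suc j)) + β * sumTo M (λ k → t k * f k j)
      ≡⟨ cong₂ _+_ (*-distribˡ-sumTo M α _) (*-distribˡ-sumTo M β _) ⟩
    sumTo M (λ k → α * (t k * f k (suc j))) + sumTo M (λ k → β * (t k * f k j))
      ≡⟨ sumTo-distrib-+ M _ _ ⟨
    sumTo M (λ k → α * (t k * f k (suc j)) + β * (t k * f k j))
      ≡⟨ sumTo-cong M (λ k → factor α β (t k) (f k (suc j)) (f k j)) ⟩
    sumTo M (λ k → t k * step n (f k) (suc j))
      ∎
    where
    α = a₁ * ι (suc j) + a₂
    β = a₁ * ι (suc n) - a₁ * ι (suc j) + a₂
    factor : ∀ α β t u v → α * (t * u) + β * (t * v) ≡ t * (α * u + β * v)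
    factor = solve-∀ ℚ-ring

  step-basis-below : ∀ k m j → j < k → step (k ℕ.+ k ℕ.+ m) (B k m) j
                   ≡ (a₁ * ι k + a₂) * B k (suc m) j + ι 2 * a₁ * ι m * B (suc k) (pred m) j
  step-basis-below (suc k) m zero    _         = vanish₁ a₂ (a₁ * ι (suc k) + a₂) (ι 2 * a₁ * ι m)
    where
    vanish₁ : ∀ a b c → a * 0ℚ ≡ b * 0ℚ + c * 0ℚ
    vanish₁ = solve-∀ ℚ-ring
  step-basis-below (suc k) m (suc j) (s≤s j<k) = begin
    α * B k m j + β * B (suc k) m j
      ≡⟨ cong₂ (λ u v → α * u + β * v) (B-below k m j j<k) (B-below (suc k) m j (ℕ.m<n⇒m<1+n j<k)) ⟩
    α * 0ℚ + β * 0ℚ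
      ≡⟨ vanish₂ α β γ δ ⟩
    γ * 0ℚ + δ * 0ℚ
      ≡⟨ cong₂ (λ u v → γ * u + δ * v) (B-below k (suc m) j j<k) (B-below (suc k) (pred m) j (ℕ.m<n⇒m<1+n j<k)) ⟨
    γ * B k (suc m) j + δ * B (suc k) (pred m) j
      ∎
    where
    α = a₁ * ι (suc j) + a₂
    β = a₁ * ι (suc (suc k ℕ.+ suc k ℕ.+ m)) - a₁ * ι (suc j) + a₂
    γ = a₁ * ι (suc k) + a₂
    δ = ι 2 * a₁ * ι m
    vanish₂ : ∀ α β γ δ → α * 0ℚ + β * 0ℚ ≡ γ * 0ℚ + δ * 0ℚ
    vanish₂ = solve-∀ ℚ-ring

  step-basis-at : ∀ k m i → step (k ℕ.+ k ℕ.+ m) (B k m) (i ℕ.+ k)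
                ≡ (a₁ * ι k + a₂) * B k (suc m) (i ℕ.+ k) + ι 2 * a₁ * ι m * B (suc k) (pred m) (i ℕ.+ k)
  step-basis-at zero    m zero    = lowest a₁ a₂ (ι 2 * a₁ * ι m)
    where
    lowest : ∀ a₁ a₂ δ → a₂ * 1ℚ ≡ (a₁ * 0ℚ + a₂) * 1ℚ + δ * 0ℚ
    lowest = solve-∀ ℚ-ring
  step-basis-at (suc k) m zero    = begin
    α * B k m k + β * B (suc k) m k
      ≡⟨ cong₂ (λ u v → α * u + β * v) (B-at k m 0) (B-below (suc k) m k (ℕ.n<1+n k)) ⟩
    α * 1ℚ + β * 0ℚ
      ≡⟨ cong (α * 1ℚ +_) (trans (*-zeroʳ β) (sym (*-zeroʳ δ))) ⟩
    α * 1ℚ + δ * 0ℚ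
      ≡⟨ cong₂ (λ u v → α * u + δ * v) (B-at k (suc m) 0) (B-below (suc k) (pred m) k (ℕ.n<1+n k)) ⟨
    α * B k (suc m) k + δ * B (suc k) (pred m) k
      ∎
    where
    α = a₁ * ι (suc k) + a₂
    β = a₁ * ι (suc (suc k ℕ.+ suc k ℕ.+ m)) - a₁ * ι (suc k) + a₂
    δ = ι 2 * a₁ * ι m
  step-basis-at k m (suc i) = begin
    (a₁ * ι (suc (i ℕ.+ k)) + a₂) * B k m (suc i ℕ.+ k)
      + (a₁ * ι (suc (k ℕ.+ k ℕ.+ m)) - a₁ * ι (suc (i ℕ.+ k)) + a₂) * B k m (i ℕ.+ k)
      ≡⟨ cong₂ (λ u v → (a₁ * ι (suc (i ℕ.+ k)) + a₂) * u + (a₁ * ι (suc (k ℕ.+ k ℕ.+ m)) - a₁ * ι (suc (i ℕ.+ k)) + a₂) * v)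
               (B-at k m (suc i)) (B-at k m i) ⟩
    (a₁ * ι (suc (i ℕ.+ k)) + a₂) * c₁ + (a₁ * ι (suc (k ℕ.+ k ℕ.+ m)) - a₁ * ι (suc (i ℕ.+ k)) + a₂) * c₀
      ≡⟨ cong₂ (λ u v → (a₁ * u + a₂) * c₁ + (a₁ * v - a₁ * u + a₂) * c₀)
               (ι-suc-+ i k) (trans (ι-suc-+ (k ℕ.+ k) m) (cong (λ u → 1ℚ + (u + ι m)) (ι-+ k k))) ⟩
    (a₁ * (1ℚ + (ι i + ι k)) + a₂) * c₁ + (a₁ * (1ℚ + ((ι k + ι k) + ι m)) - a₁ * (1ℚ + (ι i + ι k)) + a₂) * c₀
      ≡⟨ regroup a₁ a₂ (ι i) (ι k) (ι m) c₀ c₁ ⟩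
    (a₁ * ι k + a₂) * (c₀ + c₁) + a₁ * ((1ℚ + ι i) * c₁ + (ι m - ι i) * c₀)
      ≡⟨ cong (λ u → (a₁ * ι k + a₂) * (c₀ + c₁) + a₁ * (u * c₁ + (ι m - ι i) * c₀)) (ι-suc i) ⟨
    (a₁ * ι k + a₂) * (c₀ + c₁) + a₁ * (ι (suc i) * c₁ + (ι m - ι i) * c₀)
      ≡⟨ cong₂ (λ u v → (a₁ * ι k + a₂) * u + a₁ * v)
               (sym (trans (B-at k (suc m) (suc i)) (B-pascal m (suc i))))
               ([k+1]nC[k+1]+[n-k]nCk≡2n[n-1]Ck m i) ⟩
    (a₁ * ι k + a₂) * B k (suc m) (suc i ℕ.+ k) + a₁ * (ι 2 * ι m * ι (pred m C i))
      ≡⟨ cong (λ u → (a₁ * ι k + a₂) * B k (suc m) (suc i ℕ.+ k) + u)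
              (trans (reassoc a₁ (ι 2) (ι m) _) (cong (ι 2 * a₁ * ι m *_) (sym (B-at k (pred m) i)))) ⟩
    (a₁ * ι k + a₂) * B k (suc m) (suc i ℕ.+ k) + ι 2 * a₁ * ι m * B (suc k) (pred m) (suc i ℕ.+ k)
      ∎
    where
    c₀ = ι (m C i)
    c₁ = ι (m C suc i)
    regroup : ∀ a₁ a₂ i k m c₀ c₁ →
      (a₁ * (1ℚ + (i + k)) + a₂) * c₁ + (a₁ * (1ℚ + ((k + k) + m)) - a₁ * (1ℚ + (i + k)) + a₂) * c₀
      ≡ (a₁ * k + a₂) * (c₀ + c₁) + a₁ * ((1ℚ + i) * c₁ + (m - i) * c₀)
    regroup = solve-∀ ℚ-ring
    reassoc : ∀ a t m c → a * (t * m * c) ≡ t * a * m * c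
    reassoc = solve-∀ ℚ-ring

  -- For m = 0 the junk value pred 0 is harmless: its coefficient ι m vanishes.
  step-basis : ∀ k m j → step (k ℕ.+ k ℕ.+ m) (B k m) j
             ≡ (a₁ * ι k + a₂) * B k (suc m) j + ι 2 * a₁ * ι m * B (suc k) (pred m) j
  step-basis k m j with k ≤? j
  ... | no  k≰j = step-basis-below k m j (ℕ.≰⇒> k≰j)
  ... | yes k≤j rewrite sym (ℕ.m∸n+n≡m k≤j) = step-basis-at k m (j ∸ k)

  -- The truncated n ∸ (k + k) is harmless because T n k = 0 whenever n < k + k.
  module Ansatz
    (T : ℕ → ℕ → ℚ)
    (T-zero-zero : T 0 0 ≡ 1ℚ)
    (T-suc-zero  : ∀ n → T (suc n) 0 ≡ a₂ * T n 0)
    (T-suc-suc   : ∀ n k → T (suc n) (suc k)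
                   ≡ (a₁ * ι (suc k) + a₂) * T n (suc k) + ι 2 * a₁ * ι (n ∸ (k ℕ.+ k)) * T n k)
    (T-outside   : ∀ n k → n < k ℕ.+ k → T n k ≡ 0ℚ)
    where

    G : ℕ → ℕ → ℚ
    G n j = sumTo n (λ k → T n k * B k (n ∸ (k ℕ.+ k)) j)

    stay rise : ℕ → ℕ → ℕ → ℚ
    stay n j k = (a₁ * ι k + a₂) * T n k * B k (suc n ∸ (k ℕ.+ k)) j
    rise n j k = ι 2 * a₁ * ι (n ∸ (k ℕ.+ k)) * T n k * B (suc k) (pred (n ∸ (k ℕ.+ k))) j

    T-step-basis : ∀ n k j → T n k * step n (B k (n ∸ (k ℕ.+ k))) j ≡ stay n j k + rise n j k
    T-step-basis n k j with position n k
    ... | outside n<2k rewrite T-outside n k n<2k =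
      vanish (step n (B k (n ∸ (k ℕ.+ k))) j) (a₁ * ι k + a₂) (B k (suc n ∸ (k ℕ.+ k)) j)
             (ι 2 * a₁ * ι (n ∸ (k ℕ.+ k))) (B (suc k) (pred (n ∸ (k ℕ.+ k))) j)
      where
      vanish : ∀ u α v δ w → 0ℚ * u ≡ α * 0ℚ * v + δ * 0ℚ * w
      vanish = solve-∀ ℚ-ring
    ... | inside k m rewrite ℕ.+-∸-assoc 1 (ℕ.m≤m+n (k ℕ.+ k) m) | ℕ.m+n∸m≡n (k ℕ.+ k) m =
      trans (cong (T (k ℕ.+ k ℕ.+ m) k *_) (step-basis k m j))
            (distrib (T (k ℕ.+ k ℕ.+ m) k) (a₁ * ι k + a₂) (B k (suc m) j) (ι 2 * a₁ * ι m) (B (suc k) (pred m) j))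
      where
      distrib : ∀ t α u δ v → t * (α * u + δ * v) ≡ α * t * u + δ * t * v
      distrib = solve-∀ ℚ-ring

    stay-last : ∀ n j → stay n j (suc n) ≡ 0ℚ
    stay-last n j = trans (cong (λ t → α * t * b) (T-outside n (suc n) (ℕ.m<n⇒m<1+n (ℕ.m≤n+m (suc n) n))))
                          (vanish α b)
      where
      α = a₁ * ι (suc n) + a₂
      b = B (suc n) (suc n ∸ (suc n ℕ.+ suc n)) j
      vanish : ∀ α b → α * 0ℚ * b ≡ 0ℚ
      vanish = solve-∀ ℚ-ring

    T-suc-basis : ∀ n k j → T (suc n) (suc k) * B (suc k) (suc n ∸ (suc k ℕ.+ suc k)) j ≡ stay n j (suc k) + rise n j k
    T-suc-basis n k j = begin
      T (suc n) (suc k) * b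
        ≡⟨ cong (_* b) (T-suc-suc n k) ⟩
      (α * T n (suc k) + δ * T n k) * b
        ≡⟨ *-distribʳ-+ b (α * T n (suc k)) (δ * T n k) ⟩
      α * T n (suc k) * b + δ * T n k * b
        ≡⟨ cong (λ i → α * T n (suc k) * b + δ * T n k * B (suc k) i j) index ⟩
      stay n j (suc k) + rise n j k
        ∎
      where
      α = a₁ * ι (suc k) + a₂
      δ = ι 2 * a₁ * ι (n ∸ (k ℕ.+ k))
      b = B (suc k) (suc n ∸ (suc k ℕ.+ suc k)) j
      index : suc n ∸ (suc k ℕ.+ suc k) ≡ pred (n ∸ (k ℕ.+ k))
      index = trans (cong (n ∸_) (ℕ.+-suc k k)) (sym (ℕ.pred[m∸n]≡m∸[1+n] n (k ℕ.+ k)))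

    G-suc : ∀ n j → step n (G n) j ≡ G (suc n) j
    G-suc n j = begin
      step n (G n) j
        ≡⟨ step-sum n n (T n) (λ k → B k (n ∸ (k ℕ.+ k))) j ⟩
      sumTo n (λ k → T n k * step n (B k (n ∸ (k ℕ.+ k))) j)
        ≡⟨ sumTo-cong n (λ k → T-step-basis n k j) ⟩
      sumTo n (λ k → stay n j k + rise n j k)
        ≡⟨ sumTo-distrib-+ n (stay n j) (rise n j) ⟩
      sumTo n (stay n j) + sumTo n (rise n j)
        ≡⟨ cong (_+ sumTo n (rise n j)) (trans (cong (sumTo n (stay n j) +_) (stay-last n j)) (+-identityʳ (sumTo n (stay n j)))) ⟨
      (sumTo n (stay n j) + stay n j (suc n)) + sumTo n (rise n j)
        ≡⟨ cong (_+ sumTo n (rise n j)) (sumTo-suc n (stay n j)) ⟩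
      (stay n j 0 + sumTo n (λ k → stay n j (suc k))) + sumTo n (rise n j)
        ≡⟨ +-assoc (stay n j 0) _ _ ⟩
      stay n j 0 + (sumTo n (λ k → stay n j (suc k)) + sumTo n (rise n j))
        ≡⟨ cong (stay n j 0 +_) (sumTo-distrib-+ n (λ k → stay n j (suc k)) (rise n j)) ⟨
      stay n j 0 + sumTo n (λ k → stay n j (suc k) + rise n j k)
        ≡⟨ cong₂ _+_ first (sumTo-cong n (λ k → T-suc-basis n k j)) ⟨
      T (suc n) 0 * B 0 (suc n) j + sumTo n (λ k → T (suc n) (suc k) * B (suc k) (suc n ∸ (suc k ℕ.+ suc k)) j)
        ≡⟨ sumTo-suc n (λ k → T (suc n) k * B k (suc n ∸ (k ℕ.+ k)) j) ⟨
      G (suc n) j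
        ∎
      where
      first : T (suc n) 0 * B 0 (suc n) j ≡ stay n j 0
      first = trans (cong (_* B 0 (suc n) j) (T-suc-zero n)) (lowest a₁ a₂ (T n 0) (B 0 (suc n) j))
        where
        lowest : ∀ a₁ a₂ t b → a₂ * t * b ≡ (a₁ * 0ℚ + a₂) * t * b
        lowest = solve-∀ ℚ-ring

    E≡G : ∀ n j → E a₁ a₂ n j ≡ G n j
    E≡G zero    zero    = sym (cong (_* 1ℚ) T-zero-zero)
    E≡G zero    (suc j) = sym (*-zeroʳ (T 0 0))
    E≡G (suc n) j       = begin
      E a₁ a₂ (suc n) j   ≡⟨ E-suc n j ⟩
      step n (E a₁ a₂ n) j ≡⟨ step-cong n (E≡G n) j ⟩
      step n (G n) j       ≡⟨ G-suc n j ⟩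
      G (suc n) j          ∎

    T-eval-basis : ∀ n k x →
      T n k * eval n (B k (n ∸ (k ℕ.+ k))) x ≡ T n k * (x ^ k * (1ℚ + x) ^ (n ∸ (k ℕ.+ k)))
    T-eval-basis n k x with position n k
    ... | outside n<2k rewrite T-outside n k n<2k =
      trans (*-zeroˡ (eval n (B k (n ∸ (k ℕ.+ k))) x)) (sym (*-zeroˡ (x ^ k * (1ℚ + x) ^ (n ∸ (k ℕ.+ k)))))
    ... | inside k m rewrite ℕ.m+n∸m≡n (k ℕ.+ k) m = cong (T (k ℕ.+ k ℕ.+ m) k *_) (begin
      eval (k ℕ.+ k ℕ.+ m) (B k m) x   ≡⟨ cong (λ N → eval N (B k m) x) (ℕ.+-assoc k k m) ⟩
      eval (k ℕ.+ (k ℕ.+ m)) (B k m) x ≡⟨ eval-extend k (k ℕ.+ m) (B k m) x (B-above k m) ⟩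
      eval (k ℕ.+ m) (B k m) x         ≡⟨ eval-basis k m x ⟩
      x ^ k * (1ℚ + x) ^ m             ∎)

    Epoly-expansion : ∀ n x →
      Epoly a₁ a₂ n x ≡ sumTo n (λ k → T n k * (x ^ k * (1ℚ + x) ^ (n ∸ (k ℕ.+ k))))
    Epoly-expansion n x = begin
      eval n (E a₁ a₂ n) x
        ≡⟨ sumTo-cong n (λ j → cong (_* x ^ j) (E≡G n j)) ⟩
      eval n (G n) x
        ≡⟨ eval-sum n n (T n) (λ k → B k (n ∸ (k ℕ.+ k))) x ⟩
      sumTo n (λ k → T n k * eval n (B k (n ∸ (k ℕ.+ k))) x)
        ≡⟨ sumTo-cong n (λ k → T-eval-basis n k x) ⟩
      sumTo n (λ k → T n k * (x ^ k * (1ℚ + x) ^ (n ∸ (k ℕ.+ k))))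
        ∎

coefficient-inside : ∀ k m → ι (suc (k ℕ.+ k ℕ.+ m)) - ι 2 * ι (suc k) + 1ℚ ≡ ι m
coefficient-inside k m = begin
  ι (suc (k ℕ.+ k ℕ.+ m)) - ι 2 * ι (suc k) + 1ℚ
    ≡⟨ cong₂ (λ u v → u - ι 2 * v + 1ℚ) (trans (ι-suc-+ (k ℕ.+ k) m) (cong (λ u → 1ℚ + (u + ι m)) (ι-+ k k))) (ι-suc k) ⟩
  1ℚ + ((ι k + ι k) + ι m) - (1ℚ + 1ℚ) * (1ℚ + ι k) + 1ℚ
    ≡⟨ cancel (ι k) (ι m) ⟩
  ι m
    ∎
  where
  cancel : ∀ k m → 1ℚ + ((k + k) + m) - (1ℚ + 1ℚ) * (1ℚ + k) + 1ℚ ≡ m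
  cancel = solve-∀ ℚ-ring

module Triangle (a₁ a₂ c : ℚ) where

  S : ℕ → ℕ → ℚ
  S zero    zero    = 1ℚ
  S zero    (suc k) = 0ℚ
  S (suc n) zero    = a₂ * S n 0
  S (suc n) (suc k) = (a₁ * ι (suc k) + a₂) * S n (suc k) + c * (ι (suc n) - ι 2 * ι (suc k) + 1ℚ) * S n k

  mutual
    S-outside : ∀ n k → n < k ℕ.+ k → S n k ≡ 0ℚ
    S-outside zero    (suc k) _                = refl
    S-outside (suc n) (suc k) (s≤s n<k+[1+k]) = begin
      S (suc n) (suc k)
        ≡⟨ S-suc-suc n k ⟩
      α * S n (suc k) + c * ι (n ∸ (k ℕ.+ k)) * S n k
        ≡⟨ cong₂ (λ u v → α * u + c * ι v * S n k)
                 (S-outside n (suc k) (ℕ.m<n⇒m<1+n n<k+[1+k])) (ℕ.m≤n⇒m∸n≡0 n≤k+k) ⟩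
      α * 0ℚ + c * 0ℚ * S n k
        ≡⟨ vanish α c (S n k) ⟩
      0ℚ
        ∎
      where
      α = a₁ * ι (suc k) + a₂
      n≤k+k : n ℕ.≤ k ℕ.+ k
      n≤k+k = ℕ.≤-pred (subst (suc n ℕ.≤_) (ℕ.+-suc k k) n<k+[1+k])
      vanish : ∀ α c s → α * 0ℚ + c * 0ℚ * s ≡ 0ℚ
      vanish = solve-∀ ℚ-ring

    S-suc-suc : ∀ n k → S (suc n) (suc k)
              ≡ (a₁ * ι (suc k) + a₂) * S n (suc k) + c * ι (n ∸ (k ℕ.+ k)) * S n k
    S-suc-suc n k with position n k
    ... | outside n<2k rewrite S-outside n k n<2k =
      cong ((a₁ * ι (suc k) + a₂) * S n (suc k) +_)
           (trans (*-zeroʳ (c * (ι (suc n) - ι 2 * ι (suc k) + 1ℚ))) (sym (*-zeroʳ (c * ι (n ∸ (k ℕ.+ k))))))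
    ... | inside k m =
      cong (λ u → (a₁ * ι (suc k) + a₂) * S (k ℕ.+ k ℕ.+ m) (suc k) + c * u * S (k ℕ.+ k ℕ.+ m) k)
           (trans (coefficient-inside k m) (cong ι (sym (ℕ.m+n∸m≡n (k ℕ.+ k) m))))

  S-nonNeg : 0ℚ ≤ℚ a₁ → 0ℚ ≤ℚ a₂ → 0ℚ ≤ℚ c → ∀ n k → 0ℚ ≤ℚ S n k
  S-nonNeg 0≤a₁ 0≤a₂ 0≤c zero    zero    = nonNegative⁻¹ 1ℚ
  S-nonNeg 0≤a₁ 0≤a₂ 0≤c zero    (suc k) = ≤-refl
  S-nonNeg 0≤a₁ 0≤a₂ 0≤c (suc n) zero    = *-nonNeg 0≤a₂ (S-nonNeg 0≤a₁ 0≤a₂ 0≤c n 0)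
  S-nonNeg 0≤a₁ 0≤a₂ 0≤c (suc n) (suc k) = subst (0ℚ ≤ℚ_) (sym (S-suc-suc n k))
    (+-mono-≤ (*-nonNeg (+-mono-≤ (*-nonNeg 0≤a₁ (ι-nonNeg (suc k))) 0≤a₂) (S-nonNeg 0≤a₁ 0≤a₂ 0≤c n (suc k)))
              (*-nonNeg (*-nonNeg 0≤c (ι-nonNeg (n ∸ (k ℕ.+ k)))) (S-nonNeg 0≤a₁ 0≤a₂ 0≤c n k)))

  module Reduction (c>0 : 0ℚ <ℚ c) where

    instance
      c≢0 : NonZero c
      c≢0 = >-nonZero c>0

    q : ℚ
    q = (ι 2 * a₁) ÷ c

    T : ℕ → ℕ → ℚ
    T n k = S n k * q ^ k

    T-suc-zero : ∀ n → T (suc n) 0 ≡ a₂ * T n 0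
    T-suc-zero n = *-assoc a₂ (S n 0) 1ℚ

    T-suc-suc : ∀ n k → T (suc n) (suc k)
              ≡ (a₁ * ι (suc k) + a₂) * T n (suc k) + ι 2 * a₁ * ι (n ∸ (k ℕ.+ k)) * T n k
    T-suc-suc n k = begin
      S (suc n) (suc k) * (q * q ^ k)
        ≡⟨ cong (_* (q * q ^ k)) (S-suc-suc n k) ⟩
      (α * S n (suc k) + c * d * S n k) * (q * q ^ k)
        ≡⟨ regroup α (S n (suc k)) c d (S n k) q (q ^ k) ⟩
      α * (S n (suc k) * (q * q ^ k)) + c * q * d * (S n k * q ^ k)
        ≡⟨ cong (λ u → α * T n (suc k) + u * d * T n k) (trans (*-comm c q) (p÷q*q≡p (ι 2 * a₁) c)) ⟩
      α * T n (suc k) + ι 2 * a₁ * d * T n k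
        ∎
      where
      α = a₁ * ι (suc k) + a₂
      d = ι (n ∸ (k ℕ.+ k))
      regroup : ∀ α s₁ c d s₀ q r → (α * s₁ + c * d * s₀) * (q * r) ≡ α * (s₁ * (q * r)) + c * q * d * (s₀ * r)
      regroup = solve-∀ ℚ-ring

    T-outside : ∀ n k → n < k ℕ.+ k → T n k ≡ 0ℚ
    T-outside n k n<2k = trans (cong (_* q ^ k) (S-outside n k n<2k)) (*-zeroˡ (q ^ k))

    open Recurrence.Ansatz a₁ a₂ T refl T-suc-zero T-suc-suc T-outside using (Epoly-expansion)

    module _ (x : ℚ) (1+x≢0 : 1ℚ + x ≢ 0ℚ) where

      instance
        1+x≢0′ : NonZero (1ℚ + x)
        1+x≢0′ = ≢-nonZero 1+x≢0

      y : ℚ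
      y = arg a₁ c x c>0 1+x≢0

      y[1+x]²≡qx : y * (1ℚ + x) * (1ℚ + x) ≡ q * x
      y[1+x]²≡qx = trans (cong (_* (1ℚ + x)) (p÷q*q≡p (q * x ÷ (1ℚ + x)) (1ℚ + x))) (p÷q*q≡p (q * x) (1ℚ + x))

      T-term : ∀ n k → T n k * (x ^ k * (1ℚ + x) ^ (n ∸ (k ℕ.+ k))) ≡ (1ℚ + x) ^ n * (S n k * y ^ k)
      T-term n k with position n k
      ... | outside n<2k rewrite S-outside n k n<2k =
        vanish (q ^ k) (x ^ k * (1ℚ + x) ^ (n ∸ (k ℕ.+ k))) ((1ℚ + x) ^ n) (y ^ k)
        where
        vanish : ∀ a b c d → 0ℚ * a * b ≡ c * (0ℚ * d)
        vanish = solve-∀ ℚ-ring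
      ... | inside k m rewrite ℕ.m+n∸m≡n (k ℕ.+ k) m = begin
        S n′ k * q ^ k * (x ^ k * w ^ m)
          ≡⟨ regroup₁ (S n′ k) (q ^ k) (x ^ k) (w ^ m) ⟩
        S n′ k * (q ^ k * x ^ k) * w ^ m
          ≡⟨ cong (λ u → S n′ k * u * w ^ m) (sym (^-distribʳ-* q x k)) ⟩
        S n′ k * (q * x) ^ k * w ^ m
          ≡⟨ cong (λ u → S n′ k * u ^ k * w ^ m) (sym y[1+x]²≡qx) ⟩
        S n′ k * (y * w * w) ^ k * w ^ m
          ≡⟨ cong (λ u → S n′ k * u * w ^ m) (trans (^-distribʳ-* (y * w) w k) (cong (_* w ^ k) (^-distribʳ-* y w k))) ⟩
        S n′ k * (y ^ k * w ^ k * w ^ k) * w ^ m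
          ≡⟨ regroup₂ (S n′ k) (y ^ k) (w ^ k) (w ^ m) ⟩
        w ^ k * w ^ k * w ^ m * (S n′ k * y ^ k)
          ≡⟨ cong (_* (S n′ k * y ^ k)) (trans (^-distribˡ-+-* w (k ℕ.+ k) m) (cong (_* w ^ m) (^-distribˡ-+-* w k k))) ⟨
        w ^ n′ * (S n′ k * y ^ k)
          ∎
        where
        n′ = k ℕ.+ k ℕ.+ m
        w = 1ℚ + x
        regroup₁ : ∀ s a b c → s * a * (b * c) ≡ s * (a * b) * c
        regroup₁ = solve-∀ ℚ-ring
        regroup₂ : ∀ s a b c → s * (a * b * b) * c ≡ b * b * c * (s * a)
        regroup₂ = solve-∀ ℚ-ring

      E-reduction : ∀ n → Epoly a₁ a₂ n x ≡ (1ℚ + x) ^ n * poly S n y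
      E-reduction n = begin
        Epoly a₁ a₂ n x
          ≡⟨ Epoly-expansion n x ⟩
        sumTo n (λ k → T n k * (x ^ k * (1ℚ + x) ^ (n ∸ (k ℕ.+ k))))
          ≡⟨ sumTo-cong n (T-term n) ⟩
        sumTo n (λ k → (1ℚ + x) ^ n * (S n k * y ^ k))
          ≡⟨ *-distribˡ-sumTo n ((1ℚ + x) ^ n) (λ k → S n k * y ^ k) ⟨
        (1ℚ + x) ^ n * poly S n y
          ∎

theorem3p3 : (a₁ a₂ c : ℚ) → 0ℚ <ℚ a₁ → 0ℚ <ℚ a₂ → (c>0 : 0ℚ <ℚ c) →
    Σ (ℕ → ℕ → ℚ) λ S →
      ((n k : ℕ) → 0ℚ ≤ℚ S n k)
      × (S 0 0 ≡ 1ℚ)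
      × ((n k : ℕ) → suc n < 2 *ℕ k → S n k ≡ 0ℚ)
      × ((n : ℕ) → S (suc n) 0 ≡ a₂ * S n 0)
      × ((n k : ℕ) → S (suc n) (suc k)
           ≡ (a₁ * ι (suc k) + a₂) * S n (suc k)
             + c * (ι (suc n) - ι 2 * ι (suc k) + 1ℚ) * S n k)
      × ((n : ℕ) → 1 ≤ℕ n → (x : ℚ) → (1+x≢0 : 1ℚ + x ≢ 0ℚ) →
           Epoly a₁ a₂ n x ≡ (1ℚ + x) ^ n * poly S n (arg a₁ c x c>0 1+x≢0))
theorem3p3 a₁ a₂ c 0<a₁ 0<a₂ c>0 =
  S , S-nonNeg (<⇒≤ 0<a₁) (<⇒≤ 0<a₂) (<⇒≤ c>0) , refl , S-vanishes , (λ _ → refl) , (λ _ _ → refl) ,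
  λ n _ x 1+x≢0 → E-reduction x 1+x≢0 n
  where
  open Triangle a₁ a₂ c
  open Reduction c>0
  S-vanishes : ∀ n k → suc n < 2 *ℕ k → S n k ≡ 0ℚ
  S-vanishes n k 1+n<2k =
    S-outside n k (ℕ.<-trans (ℕ.n<1+n n) (subst (suc n <_) (cong (k ℕ.+_) (ℕ.+-identityʳ k)) 1+n<2k))
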